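{- Let $G$ be an $n$-vertex graph in which any two non-adjacent vertices $u,v$ satisfy $\deg(u)+\deg(v)\ge n-1$. Alternatively, let $G$ be a balanced bipartite graph on $2n$ vertices such that any two non-adjacent vertices $u,v$ lying in different halves of the bipartition satisfy $\deg(u)+\deg(v)\ge n$. Then the number of near-perfect matchings of $G$ is at most $n^2$ times the number of perfect matchings of $G$.
   Context: A near-perfect matching of a graph is a matching in which all vertices but exactly two are matched. -}

module Defs where

open import Data.Bool using (Bool; true; false; _∧_; if_then_else_)
open import Data.Nat using (ℕ; zero; suc; _≡ᵇ_)
open import Data.Fin using (Fin; toℕ)
open import Data.List using (List; []; _∷_; [_]; length; filterᵇ; map; concatMap)
open import Data.Bool.ListAction using (and)
open import Data.List.Base using (allFin)
open import Data.Vec using (Vec; lookup) renaming ([] to []ᵥ; _∷_ to _∷ᵥ_)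
open import Data.Maybe using (Maybe; just; nothing)
open import Relation.Binary.PropositionalEquality using (_≡_)

record Graph (n : ℕ) : Set where
  field
    adj    : Fin n → Fin n → Bool
    sym    : ∀ u v → adj u v ≡ adj v u
    irrefl : ∀ u → adj u u ≡ false
open Graph public

countᵇ : {n : ℕ} → (Fin n → Bool) → ℕ
countᵇ {n} p = length (filterᵇ p (allFin n))

deg : {n : ℕ} → Graph n → Fin n → ℕ
deg G u = countᵇ (adj G u)

-- A matching of G is encoded (bijectively) by its partner map
-- m : Vec (Maybe (Fin n)) n, where  m[i] = just j  iff  {i,j} is an edge of the matching,
-- and  m[i] = nothing  iff  i is unmatched.
Partner : ℕ → Set
Partner n = Vec (Maybe (Fin n)) n

pointsTo : {n : ℕ} → Maybe (Fin n) → Fin n → Bool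
pointsTo nothing  i = false
pointsTo (just k) i = toℕ k ≡ᵇ toℕ i

isMatchingᵇ : {n : ℕ} → Graph n → Partner n → Bool
isMatchingᵇ {n} G m = and (map ok (allFin n))
  where
  ok : Fin n → Bool
  ok i with lookup m i
  ... | nothing = true
  ... | just j  = adj G i j ∧ pointsTo (lookup m j) i

unmatched : {n : ℕ} → Partner n → ℕ
unmatched m = countᵇ (λ i → isNothingᵇ (lookup m i))
  where
  isNothingᵇ : {A : Set} → Maybe A → Bool
  isNothingᵇ nothing  = true
  isNothingᵇ (just _) = false

allVecs : {A : Set} → List A → (k : ℕ) → List (Vec A k)
allVecs xs zero    = [ []ᵥ ]
allVecs xs (suc k) = concatMap (λ x → map (x ∷ᵥ_) (allVecs xs k)) xs

allPartners : (n : ℕ) → List (Partner n)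
allPartners n = allVecs (nothing ∷ map just (allFin n)) n

isPerfectᵇ : {n : ℕ} → Graph n → Partner n → Bool
isPerfectᵇ G m = isMatchingᵇ G m ∧ (unmatched m ≡ᵇ 0)

isNearPerfectᵇ : {n : ℕ} → Graph n → Partner n → Bool
isNearPerfectᵇ G m = isMatchingᵇ G m ∧ (unmatched m ≡ᵇ 2)

#PM : {n : ℕ} → Graph n → ℕ
#PM {n} G = length (filterᵇ (isPerfectᵇ G) (allPartners n))

#NPM : {n : ℕ} → Graph n → ℕ
#NPM {n} G = length (filterᵇ (isNearPerfectᵇ G) (allPartners n))

{-# OPTIONS --safe #-}
module Submission where

-- For a perfect matching F and vertices u ≠ v, let splice u v F be F with u and v deleted and
-- their former partners matched to each other. Every near-perfect matching M with free vertices
-- u, v is such a splice: if uv is an edge take F = M + uv, and if some neighbour x of u has its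
-- M-partner y adjacent to v take F = M − xy + ux + vy. If neither happens, then u, v, the
-- neighbours of u and the M-partners of the neighbours of v are pairwise distinct, so
-- deg u + deg v ≤ n − 2, which the Ore condition forbids. In the bipartite case u and v lie in
-- different halves (otherwise u, v and the partners of the other half are n + 2 vertices of one
-- half), and then v, the neighbours of u and the partners of the neighbours of v are
-- deg u + deg v + 1 distinct vertices of the half of v, contradicting deg u + deg v ≥ n.
-- Hence every near-perfect matching is among the n² · #PM splices, u and v ranging over
-- n vertices each.

open import Defs hiding (sym)
open import Data.Bool using (Bool; true; false; not; T)
open import Data.Bool.Properties using (T-≡; T-not-≡; T-∧; not-¬; ¬-not; not-involutive) renaming (_≟_ to _≟ᴮ_)
open import Data.Nat using (ℕ; zero; suc; _+_; _*_; _∸_; _^_; _≤_; _≥_; _<_; z≤n; s≤s)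
open import Data.Nat.Properties using (≡ᵇ⇒≡; ≡⇒≡ᵇ; +-suc; *-identityʳ; +-cancelˡ-≡; ∸-monoˡ-≤; <⇒≱; 1+n≰n; n≤1+n; ≤-trans; module ≤-Reasoning) renaming (_≟_ to _≟ℕ_)
open import Data.Fin using (Fin; toℕ; _≟_)
open import Data.Fin.Properties using (any?; toℕ-injective)
open import Data.Maybe using (Maybe; just; nothing; fromMaybe; _>>=_)
open import Data.Maybe.Properties using (just-injective)
open import Data.Product using (_×_; _,_; proj₁; proj₂; ∃; ∃₂; uncurry)
open import Data.Sum using (_⊎_; inj₁; inj₂; [_,_])
open import Data.Unit using (tt)
open import Data.List using (List; []; _∷_; length; map; filterᵇ; concatMap; cartesianProduct; cartesianProductWith; allFin; _++_)
open import Data.List.Properties using (length-++; length-map; length-tabulate)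
open import Data.List.Membership.Propositional using (_∈_)
open import Data.List.Membership.Propositional.Properties using (∈-∃++; ∈-++⁻; ∈-++⁺ˡ; ∈-++⁺ʳ; ∈-map⁺; ∈-map⁻; ∈-allFin; ∈-filter⁺; ∈-filter⁻; ∈-cartesianProduct⁺; ∈-cartesianProductWith⁺)
open import Data.List.Relation.Binary.Disjoint.Propositional using (Disjoint)
open import Data.List.Relation.Binary.Subset.Propositional using (_⊆_)
open import Data.List.Relation.Unary.All as All using ([]; _∷_)
open import Data.List.Relation.Unary.All.Properties using (all⁺; all⁻; ¬All⇒Any¬)
open import Data.List.Relation.Unary.AllPairs using ([]; _∷_)
open import Data.List.Relation.Unary.Any as Any using (here; there)
open import Data.List.Relation.Unary.Unique.Propositional using (Unique)
import Data.List.Relation.Unary.Unique.Propositional.Properties as Unique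
open import Data.Vec using (Vec; lookup; tabulate; _[_]≔_) renaming ([] to []ᵥ; _∷_ to _∷ᵥ_)
open import Data.Vec.Properties using (lookup∘update; lookup∘update′; tabulate∘lookup; tabulate-cong) renaming (∷-injective to ∷ᵥ-injective)
open import Function using (_∘_; id; Equivalence)
open Equivalence using (to; from)
open import Relation.Nullary using (¬_; yes; no; contradiction)
open import Relation.Nullary.Decidable using (_×-dec_; T?; toSum)
open import Relation.Binary.PropositionalEquality using (_≡_; _≢_; _≗_; refl; sym; trans; cong; cong₂; subst; subst₂; module ≡-Reasoning)

variable
  A B C : Set
  n k : ℕ

Unique⇒length≤ : {xs ys : List A} → Unique xs → xs ⊆ ys → length xs ≤ length ys
Unique⇒length≤ {xs = []} _ _ = z≤n
Unique⇒length≤ {xs = x ∷ xs} (x∉xs ∷ !xs) xs⊆ys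
  with ys₁ , ys₂ , refl ← ∈-∃++ (xs⊆ys (here refl)) = begin
    suc (length xs)               ≤⟨ s≤s (Unique⇒length≤ !xs xs⊆ys₁++ys₂) ⟩
    suc (length (ys₁ ++ ys₂))     ≡⟨ cong suc (length-++ ys₁) ⟩
    suc (length ys₁ + length ys₂) ≡⟨ +-suc (length ys₁) (length ys₂) ⟨
    length ys₁ + length (x ∷ ys₂) ≡⟨ length-++ ys₁ ⟨
    length (ys₁ ++ x ∷ ys₂)       ∎
  where
  open ≤-Reasoning
  xs⊆ys₁++ys₂ : xs ⊆ ys₁ ++ ys₂
  xs⊆ys₁++ys₂ z∈xs with ∈-++⁻ ys₁ (xs⊆ys (there z∈xs))
  ... | inj₁ z∈ys₁         = ∈-++⁺ˡ z∈ys₁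
  ... | inj₂ (here refl)   = contradiction refl (All.lookup x∉xs z∈xs)
  ... | inj₂ (there z∈ys₂) = ∈-++⁺ʳ ys₁ z∈ys₂

length-filterᵇ+filterᵇ-not : (p : A → Bool) (xs : List A) →
  length (filterᵇ p xs) + length (filterᵇ (not ∘ p) xs) ≡ length xs
length-filterᵇ+filterᵇ-not p [] = refl
length-filterᵇ+filterᵇ-not p (x ∷ xs) with p x
... | true  = cong suc (length-filterᵇ+filterᵇ-not p xs)
... | false = trans (+-suc _ _) (cong suc (length-filterᵇ+filterᵇ-not p xs))

concatMap-map≡cartesianProductWith : (f : A → B → C) (xs : List A) (ys : List B) →
  concatMap (λ x → map (f x) ys) xs ≡ cartesianProductWith f xs ys
concatMap-map≡cartesianProductWith f []       ys = refl
concatMap-map≡cartesianProductWith f (x ∷ xs) ys =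
  cong (map (f x) ys ++_) (concatMap-map≡cartesianProductWith f xs ys)

length-cartesianProductWith : (f : A → B → C) (xs : List A) (ys : List B) →
  length (cartesianProductWith f xs ys) ≡ length xs * length ys
length-cartesianProductWith f []       ys = refl
length-cartesianProductWith f (x ∷ xs) ys = begin
  length (map (f x) ys ++ cartesianProductWith f xs ys)
    ≡⟨ length-++ (map (f x) ys) ⟩
  length (map (f x) ys) + length (cartesianProductWith f xs ys)
    ≡⟨ cong₂ _+_ (length-map (f x) ys) (length-cartesianProductWith f xs ys) ⟩
  length ys + length xs * length ys
    ∎
  where open ≡-Reasoning

just≢nothing : {m : Maybe A} {a : A} → m ≡ just a → m ≢ nothing
just≢nothing m≡just m≡nothing with () ← trans (sym m≡nothing) m≡just

countᵇ≢0⇒∃ : {p : Fin n → Bool} → countᵇ p ≢ 0 → ∃ (T ∘ p)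
countᵇ≢0⇒∃ {n} {p} count≢0 with filterᵇ p (allFin n) in eq
... | []    = contradiction refl count≢0
... | i ∷ _ = i , proj₂ (∈-filter⁻ (T? ∘ p) {xs = allFin n} (subst (i ∈_) (sym eq) (here refl)))

countᵇ≡2⇒exactly-two : (p : Fin n → Bool) → countᵇ p ≡ 2 →
  ∃₂ λ u v → u ≢ v × T (p u) × T (p v) × (∀ w → T (p w) → w ≡ u ⊎ w ≡ v)
countᵇ≡2⇒exactly-two {n} p _ with filterᵇ p (allFin n) in eq
... | u ∷ v ∷ [] = u , v , u≢v , satisfies (here refl) , satisfies (there (here refl)) , only
  where
  satisfies : ∀ {w} → w ∈ u ∷ v ∷ [] → T (p w)
  satisfies w∈ = proj₂ (∈-filter⁻ (T? ∘ p) {xs = allFin n} (subst (_ ∈_) (sym eq) w∈))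
  u≢v : u ≢ v
  u≢v with (u≢v ∷ []) ∷ _ ← subst Unique eq (Unique.filter⁺ (T? ∘ p) (Unique.allFin⁺ n)) = u≢v
  only : ∀ w → T (p w) → w ≡ u ⊎ w ≡ v
  only w pw with subst (w ∈_) eq (∈-filter⁺ (T? ∘ p) (∈-allFin w) pw)
  ... | here w≡u         = inj₁ w≡u
  ... | there (here w≡v) = inj₂ w≡v

allVecs-suc : (xs : List A) (k : ℕ) → allVecs xs (suc k) ≡ cartesianProductWith _∷ᵥ_ xs (allVecs xs k)
allVecs-suc xs k = concatMap-map≡cartesianProductWith _∷ᵥ_ xs (allVecs xs k)

∈-allVecs : {xs : List A} → (∀ a → a ∈ xs) → (v : Vec A k) → v ∈ allVecs xs k
∈-allVecs xs-full []ᵥ = here refl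
∈-allVecs {xs = xs} xs-full (a ∷ᵥ v) = subst (_ ∈_) (sym (allVecs-suc xs _))
  (∈-cartesianProductWith⁺ _∷ᵥ_ (xs-full a) (∈-allVecs xs-full v))

allVecs-unique : {xs : List A} → Unique xs → ∀ k → Unique (allVecs xs k)
allVecs-unique !xs zero = [] ∷ []
allVecs-unique {xs = xs} !xs (suc k) = subst Unique (sym (allVecs-suc xs k))
  (Unique.cartesianProductWith⁺ _∷ᵥ_ ∷ᵥ-injective !xs (allVecs-unique !xs k))

∈-allPartners : (M : Partner n) → M ∈ allPartners n
∈-allPartners = ∈-allVecs λ where
  nothing  → here refl
  (just i) → there (∈-map⁺ just (∈-allFin i))

allPartners-unique : Unique (allPartners n)
allPartners-unique {n} = allVecs-unique (All.tabulate nothing∉ ∷ Unique.map⁺ just-injective (Unique.allFin⁺ n)) n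
  where
  nothing∉ : ∀ {m} → m ∈ map just (allFin n) → nothing ≢ m
  nothing∉ m∈ with _ , _ , refl ← ∈-map⁻ just m∈ = λ ()

pointsTo⇒≡ : {m : Maybe (Fin n)} {i : Fin n} → T (pointsTo m i) → m ≡ just i
pointsTo⇒≡ {m = just k} {i} h = cong just (toℕ-injective (≡ᵇ⇒≡ (toℕ k) (toℕ i) h))

pointsTo-self : (i : Fin n) → T (pointsTo (just i) i)
pointsTo-self i = ≡⇒≡ᵇ (toℕ i) (toℕ i) refl

lookup-≔≔-first : (M : Vec A n) {a b : Fin n} {x y : A} → a ≢ b → lookup (M [ a ]≔ x [ b ]≔ y) a ≡ x
lookup-≔≔-first M {a} {x = x} a≢b = trans (lookup∘update′ a≢b (M [ a ]≔ x) _) (lookup∘update a M x)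

lookup-≔≔-second : (M : Vec A n) (a : Fin n) {b : Fin n} {x y : A} → lookup (M [ a ]≔ x [ b ]≔ y) b ≡ y
lookup-≔≔-second M a {b} {x} {y} = lookup∘update b (M [ a ]≔ x) y

lookup-≔≔-other : (M : Vec A n) {a b i : Fin n} {x y : A} → i ≢ a → i ≢ b →
  lookup (M [ a ]≔ x [ b ]≔ y) i ≡ lookup M i
lookup-≔≔-other M {a} {x = x} i≢a i≢b =
  trans (lookup∘update′ i≢b (M [ a ]≔ x) _) (lookup∘update′ i≢a M x)

link : Fin n → Fin n → Partner n → Partner n
link a b M = M [ a ]≔ just b [ b ]≔ just a

unlink : Fin n → Fin n → Partner n → Partner n
unlink a b M = M [ a ]≔ nothing [ b ]≔ nothing

redirect : Fin n → Fin n → Partner n → Fin n → Maybe (Fin n)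
redirect u v M j with j ≟ u | j ≟ v
... | yes _ | _     = lookup M v
... | no _  | yes _ = lookup M u
... | no _  | no _  = just j

spliceAt : Fin n → Fin n → Partner n → Fin n → Maybe (Fin n)
spliceAt u v M i with i ≟ u | i ≟ v
... | yes _ | _     = nothing
... | no _  | yes _ = nothing
... | no _  | no _  = lookup M i >>= redirect u v M

splice : Fin n → Fin n → Partner n → Partner n
splice u v M = tabulate (spliceAt u v M)

splice-≡ : {u v : Fin n} {M M′ : Partner n} → spliceAt u v M ≗ lookup M′ → splice u v M ≡ M′
splice-≡ {M′ = M′} eq = trans (tabulate-cong eq) (tabulate∘lookup M′)

module _ {u v : Fin n} {M : Partner n} where

  redirect-first : redirect u v M u ≡ lookup M v
  redirect-first with u ≟ u
  ... | yes _  = refl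
  ... | no u≢u = contradiction refl u≢u

  redirect-second : u ≢ v → redirect u v M v ≡ lookup M u
  redirect-second u≢v with v ≟ u | v ≟ v
  ... | yes v≡u | _      = contradiction (sym v≡u) u≢v
  ... | no _    | yes _  = refl
  ... | no _    | no v≢v = contradiction refl v≢v

  redirect-other : {j : Fin n} → j ≢ u → j ≢ v → redirect u v M j ≡ just j
  redirect-other {j} j≢u j≢v with j ≟ u | j ≟ v
  ... | yes j≡u | _       = contradiction j≡u j≢u
  ... | no _    | yes j≡v = contradiction j≡v j≢v
  ... | no _    | no _    = refl

  spliceAt-first : spliceAt u v M u ≡ nothing
  spliceAt-first with u ≟ u
  ... | yes _  = refl
  ... | no u≢u = contradiction refl u≢u

  spliceAt-second : spliceAt u v M v ≡ nothing
  spliceAt-second with v ≟ u | v ≟ v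
  ... | yes _ | _      = refl
  ... | no _  | yes _  = refl
  ... | no _  | no v≢v = contradiction refl v≢v

  spliceAt-other : {i j : Fin n} → i ≢ u → i ≢ v → lookup M i ≡ just j → spliceAt u v M i ≡ redirect u v M j
  spliceAt-other {i} i≢u i≢v i↦j with i ≟ u | i ≟ v
  ... | yes i≡u | _       = contradiction i≡u i≢u
  ... | no _    | yes i≡v = contradiction i≡v i≢v
  ... | no _    | no _    = cong (_>>= redirect u v M) i↦j

module Matchings {n : ℕ} (G : Graph n) where

  variable
    M F : Partner n
    a b i j u v w x z : Fin n

  record IsMatching (M : Partner n) : Set where
    field
      adjacent  : lookup M i ≡ just j → adj G i j ≡ true
      symmetric : lookup M i ≡ just j → lookup M j ≡ just i

  IsPerfect : Partner n → Set
  IsPerfect M = IsMatching M × (∀ i → lookup M i ≢ nothing)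

  record NearPerfect (M : Partner n) (u v : Fin n) : Set where
    field
      matching      : IsMatching M
      u≢v           : u ≢ v
      u-free        : lookup M u ≡ nothing
      v-free        : lookup M v ≡ nothing
      only-u-v-free : lookup M w ≡ nothing → w ≡ u ⊎ w ≡ v

  NearPerfect-sym : NearPerfect M u v → NearPerfect M v u
  NearPerfect-sym np = record
    { matching      = matching
    ; u≢v           = u≢v ∘ sym
    ; u-free        = v-free
    ; v-free        = u-free
    ; only-u-v-free = [ inj₂ , inj₁ ] ∘ only-u-v-free
    }
    where open NearPerfect np

  IsSpliceOfPerfect : Fin n → Fin n → Partner n → Set
  IsSpliceOfPerfect u v M = ∃ λ F → IsPerfect F × splice u v F ≡ M

  isMatchingᵇ⇒IsMatching : T (isMatchingᵇ G M) → IsMatching M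
  isMatchingᵇ⇒IsMatching {M} valid = record { adjacent = proj₁ ∘ checked ; symmetric = proj₂ ∘ checked }
    where
    checked : lookup M i ≡ just j → adj G i j ≡ true × lookup M j ≡ just i
    checked {i} i↦j with lookup M i | All.lookup (all⁺ _ (allFin n) valid) (∈-allFin i)
    ... | just _ | ok with refl ← i↦j = T-≡ .to (proj₁ (T-∧ .to ok)) , pointsTo⇒≡ (proj₂ (T-∧ .to ok))

  -- The per-vertex tests inside isMatchingᵇ and unmatched are local to their definitions and cannot
  -- be named, so the next two proofs argue about a failing vertex, where the test is a hypothesis.
  IsMatching⇒isMatchingᵇ : IsMatching M → T (isMatchingᵇ G M)
  IsMatching⇒isMatchingᵇ {M} m with T? (isMatchingᵇ G M)
  ... | yes valid = valid
  ... | no invalid with i , ¬ok ← Any.satisfied (¬All⇒Any¬ (T? ∘ _) (allFin n) (invalid ∘ all⁻ _))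
                   with lookup M i in i↦ | ¬ok
  ...   | nothing | ¬ok′ = contradiction tt ¬ok′
  ...   | just j  | ¬ok′ = contradiction (T-∧ .from (T-≡ .from (IsMatching.adjacent m i↦) , j↦i)) ¬ok′
    where
    j↦i : T (pointsTo (lookup M j) i)
    j↦i = subst (λ m → T (pointsTo m i)) (sym (IsMatching.symmetric m i↦)) (pointsTo-self i)

  unmatched≡0 : (∀ i → lookup M i ≢ nothing) → unmatched M ≡ 0
  unmatched≡0 {M} all-matched with unmatched M ≟ℕ 0
  ... | yes none = none
  ... | no some with i , i-free ← countᵇ≢0⇒∃ some
                with lookup M i in i↦ | i-free
  ...   | nothing | _ = contradiction i↦ (all-matched i)

  IsPerfect⇒isPerfectᵇ : IsPerfect M → T (isPerfectᵇ G M)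
  IsPerfect⇒isPerfectᵇ {M} (m , all-matched) =
    T-∧ .from (IsMatching⇒isMatchingᵇ m , ≡⇒≡ᵇ (unmatched M) 0 (unmatched≡0 {M} all-matched))

  isNearPerfectᵇ⇒NearPerfect : T (isNearPerfectᵇ G M) → ∃₂ (NearPerfect M)
  isNearPerfectᵇ⇒NearPerfect {M} near
    with valid , two-free ← T-∧ .to near
    with u , v , u≢v , u-free , v-free , only ← countᵇ≡2⇒exactly-two _ (≡ᵇ⇒≡ (unmatched M) 2 two-free)
    with lookup M u in u↦ | u-free
  ... | nothing | _ with lookup M v in v↦ | v-free
  ...   | nothing | _ = u , v , record
          { matching      = isMatchingᵇ⇒IsMatching valid
          ; u≢v           = u≢v
          ; u-free        = u↦
          ; v-free        = v↦
          ; only-u-v-free = free⇒u∨v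
          }
    where
    free⇒u∨v : lookup M w ≡ nothing → w ≡ u ⊎ w ≡ v
    free⇒u∨v {w} _ with lookup M w | only w
    ... | nothing | only-w = only-w tt

  neighbours : Fin n → List (Fin n)
  neighbours u = filterᵇ (adj G u) (allFin n)

  ∈-neighbours⁻ : z ∈ neighbours u → adj G u z ≡ true
  ∈-neighbours⁻ {u = u} z∈ = T-≡ .to (proj₂ (∈-filter⁻ (T? ∘ adj G u) {xs = allFin n} z∈))

  neighbours-unique : Unique (neighbours u)
  neighbours-unique = Unique.filter⁺ _ (Unique.allFin⁺ n)

  adj⇒≢ : adj G i j ≡ true → i ≢ j
  adj⇒≢ {i} ij refl with () ← trans (sym ij) (irrefl G i)

  adj-sym : adj G i j ≡ true → adj G j i ≡ true
  adj-sym {i} {j} ij = trans (Graph.sym G j i) ij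

  mate : Partner n → Fin n → Fin n
  mate M i = fromMaybe i (lookup M i)

  mate-of-matched : lookup M i ≡ just j → mate M i ≡ j
  mate-of-matched {i = i} = cong (fromMaybe i)

  mate-of-free : lookup M i ≡ nothing → mate M i ≡ i
  mate-of-free {i = i} = cong (fromMaybe i)

  mate-involutive : IsMatching M → ∀ i → mate M (mate M i) ≡ i
  mate-involutive {M} m i with lookup M i in i↦
  ... | nothing = mate-of-free {M} i↦
  ... | just j  = mate-of-matched {M} (IsMatching.symmetric m i↦)

  mate-injective : IsMatching M → mate M i ≡ mate M j → i ≡ j
  mate-injective {M} {i} {j} m eq = begin
    i                  ≡⟨ mate-involutive m i ⟨
    mate M (mate M i)  ≡⟨ cong (mate M) eq ⟩
    mate M (mate M j)  ≡⟨ mate-involutive m j ⟩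
    j                  ∎
    where open ≡-Reasoning

  mate≡free⇒≡ : IsMatching M → lookup M w ≡ nothing → mate M z ≡ w → z ≡ w
  mate≡free⇒≡ {M} m w-free eq = mate-injective m (trans eq (sym (mate-of-free {M} w-free)))

  partner≢free : IsMatching M → lookup M i ≡ just j → lookup M w ≡ nothing → j ≢ w
  partner≢free m i↦j w-free refl with () ← trans (sym w-free) (IsMatching.symmetric m i↦j)

  link-isMatching : IsMatching M → adj G a b ≡ true → lookup M a ≡ nothing → lookup M b ≡ nothing →
    IsMatching (link a b M)
  link-isMatching {M} {a} {b} m ab a-free b-free = record { adjacent = proj₁ ∘ linked ; symmetric = proj₂ ∘ linked }
    where
    linked : lookup (link a b M) i ≡ just j → adj G i j ≡ true × lookup (link a b M) j ≡ just i
    linked {i} {j} i↦j with i ≟ b | i ≟ a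
    ... | yes refl | _ with refl ← trans (sym (lookup-≔≔-second M a)) i↦j =
      adj-sym ab , lookup-≔≔-first M (adj⇒≢ ab)
    ... | no i≢b | yes refl with refl ← trans (sym (lookup-≔≔-first M i≢b)) i↦j =
      ab , lookup-≔≔-second M a
    ... | no i≢b | no i≢a =
      IsMatching.adjacent m i↦ , trans (lookup-≔≔-other M j≢a j≢b) (IsMatching.symmetric m i↦)
      where
      i↦ : lookup M i ≡ just j
      i↦ = trans (sym (lookup-≔≔-other M i≢a i≢b)) i↦j
      j≢a : j ≢ a
      j≢a = partner≢free m i↦ a-free
      j≢b : j ≢ b
      j≢b = partner≢free m i↦ b-free

  unlink-isMatching : IsMatching M → lookup M a ≡ just b → IsMatching (unlink a b M)
  unlink-isMatching {M} {a} {b} m a↦b = record { adjacent = proj₁ ∘ unlinked ; symmetric = proj₂ ∘ unlinked }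
    where
    b↦a : lookup M b ≡ just a
    b↦a = IsMatching.symmetric m a↦b
    unlinked : lookup (unlink a b M) i ≡ just j → adj G i j ≡ true × lookup (unlink a b M) j ≡ just i
    unlinked {i} {j} i↦j with i ≟ a | i ≟ b
    ... | yes refl | _    = contradiction (lookup-≔≔-first M (adj⇒≢ (IsMatching.adjacent m a↦b))) (just≢nothing i↦j)
    ... | no _ | yes refl = contradiction (lookup-≔≔-second M a) (just≢nothing i↦j)
    ... | no i≢a | no i≢b =
      IsMatching.adjacent m i↦ , trans (lookup-≔≔-other M j≢a j≢b) (IsMatching.symmetric m i↦)
      where
      i↦ : lookup M i ≡ just j
      i↦ = trans (sym (lookup-≔≔-other M i≢a i≢b)) i↦j
      j≢a : j ≢ a
      j≢a refl = i≢b (just-injective (trans (sym (IsMatching.symmetric m i↦)) a↦b))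
      j≢b : j ≢ b
      j≢b refl = i≢a (just-injective (trans (sym (IsMatching.symmetric m i↦)) b↦a))

  module _ (np : NearPerfect M u v) where
    open NearPerfect np

    matched-to-mate : w ≢ u → w ≢ v → lookup M w ≡ just (mate M w)
    matched-to-mate {w} w≢u w≢v with lookup M w in w↦
    ... | just _  = refl
    ... | nothing = contradiction (only-u-v-free w↦) [ w≢u , w≢v ]

    mate-adjacent : w ≢ u → w ≢ v → adj G w (mate M w) ≡ true
    mate-adjacent w≢u w≢v = IsMatching.adjacent matching (matched-to-mate w≢u w≢v)

    -- Matching on toSum (i ≟ u) rather than on i ≟ u keeps spliceAt u v F i folded in the goal.
    splice-≡-outside-free : (∀ {i} → i ≢ u → i ≢ v → spliceAt u v F i ≡ lookup M i) → splice u v F ≡ M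
    splice-≡-outside-free {F} outside = splice-≡ pointwise
      where
      pointwise : spliceAt u v F ≗ lookup M
      pointwise i with toSum (i ≟ u) | toSum (i ≟ v)
      ... | inj₁ refl | _         = trans (spliceAt-first {u = i} {v} {F}) (sym u-free)
      ... | inj₂ _    | inj₁ refl = trans (spliceAt-second {u = u} {i} {F}) (sym v-free)
      ... | inj₂ i≢u  | inj₂ i≢v  = outside i≢u i≢v

    spliceAt-unchanged : i ≢ u → i ≢ v → lookup F i ≡ lookup M i → spliceAt u v F i ≡ lookup M i
    spliceAt-unchanged {i} {F} i≢u i≢v Fi≡Mi = begin
      spliceAt u v F i           ≡⟨ spliceAt-other i≢u i≢v (trans Fi≡Mi i↦) ⟩
      redirect u v F (mate M i)  ≡⟨ redirect-other (partner≢free matching i↦ u-free)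
                                                   (partner≢free matching i↦ v-free) ⟩
      just (mate M i)            ≡⟨ i↦ ⟨
      lookup M i                 ∎
      where
      open ≡-Reasoning
      i↦ : lookup M i ≡ just (mate M i)
      i↦ = matched-to-mate i≢u i≢v

  edge-preimage : NearPerfect M u v → adj G u v ≡ true → IsSpliceOfPerfect u v M
  edge-preimage {M} {u} {v} np uv = link u v M , (linked , perfect) , splice-≡-outside-free np unchanged
    where
    open NearPerfect np
    linked : IsMatching (link u v M)
    linked = link-isMatching matching uv u-free v-free
    perfect : ∀ i → lookup (link u v M) i ≢ nothing
    perfect i with toSum (i ≟ u) | toSum (i ≟ v)
    ... | inj₁ refl | _         = just≢nothing (lookup-≔≔-first M u≢v)
    ... | inj₂ _    | inj₁ refl = just≢nothing (lookup-≔≔-second M u)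
    ... | inj₂ i≢u  | inj₂ i≢v  =
      just≢nothing (trans (lookup-≔≔-other M i≢u i≢v) (matched-to-mate np i≢u i≢v))
    unchanged : i ≢ u → i ≢ v → spliceAt u v (link u v M) i ≡ lookup M i
    unchanged i≢u i≢v = spliceAt-unchanged np i≢u i≢v (lookup-≔≔-other M i≢u i≢v)

  module Switch (np : NearPerfect M u v) (ux : adj G u x ≡ true) (vy : adj G v (mate M x) ≡ true) where
    open NearPerfect np

    y : Fin n
    y = mate M x

    x≢u : x ≢ u
    x≢u = adj⇒≢ ux ∘ sym

    x≢v : x ≢ v
    x≢v refl = adj⇒≢ vy (sym (mate-of-free {M} v-free))

    x↦y : lookup M x ≡ just y
    x↦y = matched-to-mate np x≢u x≢v

    y↦x : lookup M y ≡ just x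
    y↦x = IsMatching.symmetric matching x↦y

    x≢y : x ≢ y
    x≢y = adj⇒≢ (IsMatching.adjacent matching x↦y)

    y≢u : y ≢ u
    y≢u = partner≢free matching x↦y u-free

    y≢v : y ≢ v
    y≢v = partner≢free matching x↦y v-free

    M₀ M₁ switched : Partner n
    M₀       = unlink x y M
    M₁       = link u x M₀
    switched = link v y M₁

    switched-u : lookup switched u ≡ just x
    switched-u = trans (lookup-≔≔-other M₁ u≢v (y≢u ∘ sym)) (lookup-≔≔-first M₀ (x≢u ∘ sym))

    switched-v : lookup switched v ≡ just y
    switched-v = lookup-≔≔-first M₁ (y≢v ∘ sym)

    switched-x : lookup switched x ≡ just u
    switched-x = trans (lookup-≔≔-other M₁ x≢v x≢y) (lookup-≔≔-second M₀ u)

    switched-y : lookup switched y ≡ just v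
    switched-y = lookup-≔≔-second M₁ v

    switched-other : i ≢ u → i ≢ v → i ≢ x → i ≢ y → lookup switched i ≡ lookup M i
    switched-other i≢u i≢v i≢x i≢y =
      trans (lookup-≔≔-other M₁ i≢v i≢y)
        (trans (lookup-≔≔-other M₀ i≢u i≢x) (lookup-≔≔-other M i≢x i≢y))

    switched-isMatching : IsMatching switched
    switched-isMatching =
      link-isMatching (link-isMatching (unlink-isMatching matching x↦y) ux M₀-u M₀-x) vy M₁-v M₁-y
      where
      M₀-u : lookup M₀ u ≡ nothing
      M₀-u = trans (lookup-≔≔-other M (x≢u ∘ sym) (y≢u ∘ sym)) u-free
      M₀-x : lookup M₀ x ≡ nothing
      M₀-x = lookup-≔≔-first M x≢y
      M₁-v : lookup M₁ v ≡ nothing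
      M₁-v = trans (lookup-≔≔-other M₀ (u≢v ∘ sym) (x≢v ∘ sym))
               (trans (lookup-≔≔-other M (x≢v ∘ sym) (y≢v ∘ sym)) v-free)
      M₁-y : lookup M₁ y ≡ nothing
      M₁-y = trans (lookup-≔≔-other M₀ y≢u (x≢y ∘ sym)) (lookup-≔≔-second M x)

    switched-perfect : ∀ i → lookup switched i ≢ nothing
    switched-perfect i with toSum (i ≟ u) | toSum (i ≟ v) | toSum (i ≟ x) | toSum (i ≟ y)
    ... | inj₁ refl | _         | _         | _         = just≢nothing switched-u
    ... | inj₂ _    | inj₁ refl | _         | _         = just≢nothing switched-v
    ... | inj₂ _    | inj₂ _    | inj₁ refl | _         = just≢nothing switched-x
    ... | inj₂ _    | inj₂ _    | inj₂ _    | inj₁ refl = just≢nothing switched-y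
    ... | inj₂ i≢u  | inj₂ i≢v  | inj₂ i≢x  | inj₂ i≢y  =
      just≢nothing (trans (switched-other i≢u i≢v i≢x i≢y) (matched-to-mate np i≢u i≢v))

    spliceAt-switched : i ≢ u → i ≢ v → spliceAt u v switched i ≡ lookup M i
    spliceAt-switched {i} i≢u i≢v with toSum (i ≟ x) | toSum (i ≟ y)
    ... | inj₁ refl | _ = begin
      spliceAt u v switched x  ≡⟨ spliceAt-other i≢u i≢v switched-x ⟩
      redirect u v switched u  ≡⟨ redirect-first {u = u} {v} {switched} ⟩
      lookup switched v        ≡⟨ switched-v ⟩
      just y                   ≡⟨ x↦y ⟨
      lookup M x               ∎
      where open ≡-Reasoning
    ... | inj₂ _ | inj₁ refl = begin
      spliceAt u v switched y  ≡⟨ spliceAt-other i≢u i≢v switched-y ⟩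
      redirect u v switched v  ≡⟨ redirect-second {M = switched} u≢v ⟩
      lookup switched u        ≡⟨ switched-u ⟩
      just x                   ≡⟨ y↦x ⟨
      lookup M y               ∎
      where open ≡-Reasoning
    ... | inj₂ i≢x | inj₂ i≢y = spliceAt-unchanged np i≢u i≢v (switched-other i≢u i≢v i≢x i≢y)

    switch-preimage : IsSpliceOfPerfect u v M
    switch-preimage = switched , (switched-isMatching , switched-perfect) , splice-≡-outside-free np spliceAt-switched

  open Switch using (switch-preimage)

  no-switch⇒distinct : NearPerfect M u v → adj G u v ≡ false →
    ¬ (∃ λ x → adj G u x ≡ true × adj G v (mate M x) ≡ true) →
    Unique (u ∷ v ∷ neighbours u ++ map (mate M) (neighbours v))
  no-switch⇒distinct {M} {u} {v} np u≁v no-switch =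
    (u≢v ∷ All.tabulate u∉) ∷ All.tabulate v∉ ∷
    Unique.++⁺ neighbours-unique (Unique.map⁺ (mate-injective matching) neighbours-unique) disjoint
    where
    open NearPerfect np
    disjoint : Disjoint (neighbours u) (map (mate M) (neighbours v))
    disjoint (z∈Nu , z∈mNv) with y , y∈Nv , refl ← ∈-map⁻ (mate M) z∈mNv =
      no-switch (mate M y , ∈-neighbours⁻ z∈Nu ,
                 subst (λ w → adj G v w ≡ true) (sym (mate-involutive matching y)) (∈-neighbours⁻ y∈Nv))
    u∉ : z ∈ neighbours u ++ map (mate M) (neighbours v) → u ≢ z
    u∉ z∈ u≡z with ∈-++⁻ (neighbours u) z∈
    ... | inj₁ z∈Nu = adj⇒≢ (∈-neighbours⁻ z∈Nu) u≡z
    ... | inj₂ z∈mNv with y , y∈Nv , refl ← ∈-map⁻ (mate M) z∈mNv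
                     with refl ← mate≡free⇒≡ matching u-free (sym u≡z) =
      contradiction (trans (sym (∈-neighbours⁻ y∈Nv)) (trans (Graph.sym G v y) u≁v)) λ ()
    v∉ : z ∈ neighbours u ++ map (mate M) (neighbours v) → v ≢ z
    v∉ z∈ v≡z with ∈-++⁻ (neighbours u) z∈
    ... | inj₁ z∈Nu =
      contradiction (trans (sym (∈-neighbours⁻ z∈Nu)) (subst (λ w → adj G u w ≡ false) v≡z u≁v)) λ ()
    ... | inj₂ z∈mNv with y , y∈Nv , refl ← ∈-map⁻ (mate M) z∈mNv =
      adj⇒≢ (∈-neighbours⁻ y∈Nv) (sym (mate≡free⇒≡ matching v-free (sym v≡z)))

  preimage-or-distinct : NearPerfect M u v →
    IsSpliceOfPerfect u v M ⊎
    (adj G u v ≡ false × Unique (u ∷ v ∷ neighbours u ++ map (mate M) (neighbours v)))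
  preimage-or-distinct {M} {u} {v} np
    with adj G u v in uv | any? (λ x → (adj G u x ≟ᴮ true) ×-dec (adj G v (mate M x) ≟ᴮ true))
  ... | true  | _                 = inj₁ (edge-preimage np uv)
  ... | false | yes (x , ux , vy) = inj₁ (switch-preimage np ux vy)
  ... | false | no no-switch      = inj₂ (refl , no-switch⇒distinct np uv no-switch)

  length-neighbours++mates : length (neighbours u ++ map (mate M) (neighbours v)) ≡ deg G u + deg G v
  length-neighbours++mates {u} {M} {v} =
    trans (length-++ (neighbours u)) (cong (deg G u +_) (length-map (mate M) (neighbours v)))

  #NPM≤ : {m : ℕ} (A B : List (Fin n)) → length A ≡ m → length B ≡ m →
    (∀ {M u v} → NearPerfect M u v → ∃₂ λ a b → a ∈ A × b ∈ B × IsSpliceOfPerfect a b M) →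
    #NPM G ≤ m ^ 2 * #PM G
  #NPM≤ {m} A B |A|≡m |B|≡m cover = begin
    #NPM G                                ≤⟨ Unique⇒length≤ (Unique.filter⁺ _ allPartners-unique) near⊆splices ⟩
    length splices                        ≡⟨ length-cartesianProductWith (uncurry splice) (cartesianProduct A B) perfect ⟩
    length (cartesianProduct A B) * #PM G ≡⟨ cong (_* #PM G) (length-cartesianProductWith _,_ A B) ⟩
    length A * length B * #PM G           ≡⟨ cong₂ (λ a b → a * b * #PM G) |A|≡m |B|≡m ⟩
    m * m * #PM G                         ≡⟨ cong (λ k → m * k * #PM G) (*-identityʳ m) ⟨
    m ^ 2 * #PM G                         ∎
    where
    open ≤-Reasoning
    perfect splices : List (Partner n)
    perfect = filterᵇ (isPerfectᵇ G) (allPartners n)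
    splices = cartesianProductWith (uncurry splice) (cartesianProduct A B) perfect
    near⊆splices : filterᵇ (isNearPerfectᵇ G) (allPartners n) ⊆ splices
    near⊆splices {M} M∈
      with u , v , np ← isNearPerfectᵇ⇒NearPerfect {M}
                          (proj₂ (∈-filter⁻ (T? ∘ isNearPerfectᵇ G) {xs = allPartners n} M∈))
      with a , b , a∈A , b∈B , F , F-perfect , refl ← cover np =
      ∈-cartesianProductWith⁺ (uncurry splice) (∈-cartesianProduct⁺ a∈A b∈B)
        (∈-filter⁺ (T? ∘ isPerfectᵇ G) (∈-allPartners F) (IsPerfect⇒isPerfectᵇ F-perfect))

ore-bound : (n : ℕ) (G : Graph n) →
  (∀ u v → u ≢ v → adj G u v ≡ false → deg G u + deg G v ≥ n ∸ 1) →
  #NPM G ≤ n ^ 2 * #PM G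
ore-bound n G ore = #NPM≤ {m = n} (allFin n) (allFin n) (length-tabulate id) (length-tabulate id) cover
  where
  open Matchings G
  cover : NearPerfect M u v → ∃₂ λ a b → a ∈ allFin n × b ∈ allFin n × IsSpliceOfPerfect a b M
  cover {M} {u} {v} np with preimage-or-distinct np
  ... | inj₁ spliced = u , v , ∈-allFin u , ∈-allFin v , spliced
  ... | inj₂ (u≁v , distinct) = contradiction (ore u v (NearPerfect.u≢v np) u≁v) (<⇒≱ (∸-monoˡ-≤ 1 too-many))
    where
    open ≤-Reasoning
    too-many : 2 + (deg G u + deg G v) ≤ n
    too-many = begin
      2 + (deg G u + deg G v)                                       ≡⟨ cong (2 +_) (length-neighbours++mates {u} {M} {v}) ⟨
      length (u ∷ v ∷ neighbours u ++ map (mate M) (neighbours v))  ≤⟨ Unique⇒length≤ distinct (λ _ → ∈-allFin _) ⟩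
      length (allFin n)                                             ≡⟨ length-tabulate id ⟩
      n                                                             ∎

module Bipartite {n : ℕ} (G : Graph (n + n)) (side : Fin (n + n) → Bool) (balanced : countᵇ side ≡ n)
  (bipartite : ∀ u v → adj G u v ≡ true → side u ≢ side v) where
  open Matchings G

  Side : Bool → List (Fin (n + n))
  Side true  = filterᵇ side (allFin (n + n))
  Side false = filterᵇ (not ∘ side) (allFin (n + n))

  ∈-Side⁺ : {b : Bool} {i : Fin (n + n)} → side i ≡ b → i ∈ Side b
  ∈-Side⁺ {true}  si = ∈-filter⁺ (T? ∘ side) (∈-allFin _) (T-≡ .from si)
  ∈-Side⁺ {false} si = ∈-filter⁺ (T? ∘ not ∘ side) (∈-allFin _) (T-not-≡ .from si)

  ∈-Side⁻ : {b : Bool} {i : Fin (n + n)} → i ∈ Side b → side i ≡ b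
  ∈-Side⁻ {true}  i∈ = T-≡ .to (proj₂ (∈-filter⁻ (T? ∘ side) {xs = allFin (n + n)} i∈))
  ∈-Side⁻ {false} i∈ = T-not-≡ .to (proj₂ (∈-filter⁻ (T? ∘ not ∘ side) {xs = allFin (n + n)} i∈))

  Side-unique : (b : Bool) → Unique (Side b)
  Side-unique true  = Unique.filter⁺ _ (Unique.allFin⁺ (n + n))
  Side-unique false = Unique.filter⁺ _ (Unique.allFin⁺ (n + n))

  length-Side : (b : Bool) → length (Side b) ≡ n
  length-Side true  = balanced
  length-Side false = +-cancelˡ-≡ n _ _ (begin
    n + length (Side false)                  ≡⟨ cong (_+ length (Side false)) balanced ⟨
    length (Side true) + length (Side false) ≡⟨ length-filterᵇ+filterᵇ-not side (allFin (n + n)) ⟩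
    length (allFin (n + n))                  ≡⟨ length-tabulate id ⟩
    n + n                                    ∎)
    where open ≡-Reasoning

  adj⇒other-side : adj G a z ≡ true → side z ≡ not (side a)
  adj⇒other-side {a} {z} az = ¬-not (bipartite a z az ∘ sym)

  module _ (np : NearPerfect M u v) where
    open NearPerfect np

    mate-other-side : w ≢ u → w ≢ v → side (mate M w) ≡ not (side w)
    mate-other-side w≢u w≢v = adj⇒other-side (mate-adjacent np w≢u w≢v)

    free-vertices-on-opposite-sides : side u ≢ side v
    free-vertices-on-opposite-sides su≡sv = 1+n≰n (≤-trans (n≤1+n (suc n)) (begin
      2 + n
        ≡⟨ cong (2 +_) (trans (length-map (mate M) (Side (not s))) (length-Side (not s))) ⟨
      length (u ∷ v ∷ map (mate M) (Side (not s)))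
        ≤⟨ Unique⇒length≤ distinct ⊆Side ⟩
      length (Side s)
        ≡⟨ length-Side s ⟩
      n ∎))
      where
      open ≤-Reasoning
      s : Bool
      s = side u
      ≢free : {w : Fin (n + n)} → w ∈ Side (not s) → w ≢ u × w ≢ v
      ≢free w∈ = (λ { refl → not-¬ refl (∈-Side⁻ w∈) }) ,
                 (λ { refl → not-¬ refl (trans su≡sv (∈-Side⁻ w∈)) })
      ⊆Side : u ∷ v ∷ map (mate M) (Side (not s)) ⊆ Side s
      ⊆Side (here refl)         = ∈-Side⁺ refl
      ⊆Side (there (here refl)) = ∈-Side⁺ (sym su≡sv)
      ⊆Side (there (there z∈)) with w , w∈ , refl ← ∈-map⁻ (mate M) z∈ =
        ∈-Side⁺ (trans (uncurry mate-other-side (≢free w∈)) (trans (cong not (∈-Side⁻ w∈)) (not-involutive s)))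
      distinct : Unique (u ∷ v ∷ map (mate M) (Side (not s)))
      distinct = (u≢v ∷ All.tabulate u∉) ∷ All.tabulate v∉ ∷
                 Unique.map⁺ (mate-injective matching) (Side-unique (not s))
        where
        u∉ : z ∈ map (mate M) (Side (not s)) → u ≢ z
        u∉ z∈ u≡z with w , w∈ , refl ← ∈-map⁻ (mate M) z∈ =
          proj₁ (≢free w∈) (mate≡free⇒≡ matching u-free (sym u≡z))
        v∉ : z ∈ map (mate M) (Side (not s)) → v ≢ z
        v∉ z∈ v≡z with w , w∈ , refl ← ∈-map⁻ (mate M) z∈ =
          proj₂ (≢free w∈) (mate≡free⇒≡ matching v-free (sym v≡z))

    cross-distinct⇒deg+deg<n : side u ≡ true → side v ≡ false → adj G u v ≡ false →
      Unique (v ∷ neighbours u ++ map (mate M) (neighbours v)) → deg G u + deg G v < n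
    cross-distinct⇒deg+deg<n su sv u≁v distinct = begin
      suc (deg G u + deg G v)                                   ≡⟨ cong suc (length-neighbours++mates {u} {M} {v}) ⟨
      length (v ∷ neighbours u ++ map (mate M) (neighbours v))  ≤⟨ Unique⇒length≤ distinct ⊆Side-false ⟩
      length (Side false)                                       ≡⟨ length-Side false ⟩
      n                                                         ∎
      where
      open ≤-Reasoning
      ⊆Side-false : v ∷ neighbours u ++ map (mate M) (neighbours v) ⊆ Side false
      ⊆Side-false (here refl) = ∈-Side⁺ sv
      ⊆Side-false (there z∈) with ∈-++⁻ (neighbours u) z∈
      ... | inj₁ z∈Nu = ∈-Side⁺ (trans (adj⇒other-side (∈-neighbours⁻ z∈Nu)) (cong not su))
      ... | inj₂ z∈mNv with y , y∈Nv , refl ← ∈-map⁻ (mate M) z∈mNv =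
        ∈-Side⁺ (trans (mate-other-side y≢u y≢v)
                  (trans (cong not (adj⇒other-side vy)) (trans (not-involutive (side v)) sv)))
        where
        vy : adj G v y ≡ true
        vy = ∈-neighbours⁻ y∈Nv
        y≢u : y ≢ u
        y≢u refl = contradiction (trans (sym vy) (trans (Graph.sym G v u) u≁v)) λ ()
        y≢v : y ≢ v
        y≢v = adj⇒≢ vy ∘ sym

bipartite-bound : (n : ℕ) (G : Graph (n + n)) (side : Fin (n + n) → Bool) → countᵇ side ≡ n →
  (∀ u v → adj G u v ≡ true → side u ≢ side v) →
  (∀ u v → side u ≢ side v → adj G u v ≡ false → deg G u + deg G v ≥ n) →
  #NPM G ≤ n ^ 2 * #PM G
bipartite-bound n G side balanced bipartite dense =
  #NPM≤ {m = n} (Side true) (Side false) (length-Side true) (length-Side false) cover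
  where
  open Matchings G
  open Bipartite G side balanced bipartite
  Covered : Partner (n + n) → Set
  Covered M = ∃₂ λ a b → a ∈ Side true × b ∈ Side false × IsSpliceOfPerfect a b M
  oriented : NearPerfect M a b → side a ≡ true → side b ≡ false → Covered M
  oriented {a = a} {b} np sa sb with preimage-or-distinct np
  ... | inj₁ spliced = a , b , ∈-Side⁺ sa , ∈-Side⁺ sb , spliced
  ... | inj₂ (a≁b , _ ∷ distinct) =
    contradiction (dense a b (subst₂ _≢_ (sym sa) (sym sb) λ ()) a≁b)
                  (<⇒≱ (cross-distinct⇒deg+deg<n np sa sb a≁b distinct))
  cover : NearPerfect M u v → Covered M
  cover {u = u} {v} np with side u in su | side v in sv
  ... | true  | false = oriented np su sv
  ... | false | true  = oriented (NearPerfect-sym np) sv su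
  ... | true  | true  = contradiction (trans su (sym sv)) (free-vertices-on-opposite-sides np)
  ... | false | false = contradiction (trans su (sym sv)) (free-vertices-on-opposite-sides np)

lemma2p1 :
    -- Part 1 (Ore-type condition on an n-vertex graph)
    (∀ (n : ℕ) (G : Graph n) →
      (∀ (u v : Fin n) → u ≢ v → adj G u v ≡ false → deg G u + deg G v ≥ n ∸ 1) →
      #NPM G ≤ n ^ 2 * #PM G)
    ×
    -- Part 2 (balanced bipartite graph on 2n vertices, halves given by side)
    (∀ (n : ℕ) (G : Graph (n + n)) (side : Fin (n + n) → Bool) →
      countᵇ side ≡ n →
      (∀ (u v : Fin (n + n)) → adj G u v ≡ true → side u ≢ side v) →
      (∀ (u v : Fin (n + n)) → side u ≢ side v → adj G u v ≡ false → deg G u + deg G v ≥ n) →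
      #NPM G ≤ n ^ 2 * #PM G)
lemma2p1 = ore-bound , bipartite-bound
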